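{- Let $\mathbf{R}_{g\times g}=(\mathbf{V},\mathbf{E})$ be the rook graph and let $\mathbf{X},\mathbf{X}'\subseteq\mathbf{V}$ with $|\mathbf{X}|\ge 3$, $|\mathbf{X}'|\ge 3$ and $\mathbf{X}\times\mathbf{X}'\subseteq\mathbf{E}$. Then all vertices of $\mathbf{X}\cup\mathbf{X}'$ lie in the same row or all lie in the same column.
   Context: The rook graph is the directed graph $\mathbf{R}_{g\times g}=(\mathbf{V},\mathbf{E})$ with $\mathbf{V}=\{1,\dots,g\}\times\{1,\dots,g\}$ and $\mathbf{E}=\{((r_1,c_1),(r_2,c_2))\mid r_1=r_2 \text{ or } c_1=c_2\}$. A vertex $(r,c)$ lies in row $r$ and column $c$. -}

module Defs where

open import Data.Nat using (ℕ)
open import Data.Bool using (Bool; true)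
open import Data.Fin using (Fin)
open import Data.List using (List; length; filterᵇ; allFin; cartesianProduct)
open import Data.Product using (_×_; _,_; proj₁; proj₂)
open import Data.Sum using (_⊎_)
open import Relation.Binary.PropositionalEquality using (_≡_)

Vertex : ℕ → Set
Vertex g = Fin g × Fin g

row : ∀ {g} → Vertex g → Fin g
row = proj₁

col : ∀ {g} → Vertex g → Fin g
col = proj₂

Edge : ∀ {g} → Vertex g → Vertex g → Set
Edge u v = (row u ≡ row v) ⊎ (col u ≡ col v)

VSet : ℕ → Set
VSet g = Vertex g → Bool

_∈V_ : ∀ {g} → Vertex g → VSet g → Set
v ∈V X = X v ≡ true

allVertices : (g : ℕ) → List (Vertex g)
allVertices g = cartesianProduct (allFin g) (allFin g)

card : ∀ {g} → VSet g → ℕ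
card {g} X = length (filterᵇ X (allVertices g))

module Submission where

open import Defs
open import Data.Nat using (ℕ; _≥_; _<_; s≤s⁻¹)
open import Data.Nat.Properties using (<-≤-trans; ≤-trans; n≤1+n)
open import Data.Fin using (Fin)
import Data.Fin.Properties as Fin
open import Data.Product using (Σ; ∃-syntax; _×_; _,_; proj₂)
open import Data.Product.Properties using (≡-dec)
open import Data.Sum using (_⊎_; inj₁; inj₂)
open import Data.Empty using (⊥-elim)
open import Data.Bool using (T?)
open import Data.Bool.Properties using (T-≡)
open import Data.List using (List; []; _∷_; length; filter)
open import Data.List.Properties using (filter-notAll)
open import Data.List.Relation.Unary.Any using (here; there)
import Data.List.Relation.Unary.Any as Any
import Data.List.Relation.Unary.All as All
open import Data.List.Relation.Unary.AllPairs using (_∷_)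
open import Data.List.Relation.Unary.Unique.Propositional using (Unique)
import Data.List.Relation.Unary.Unique.Propositional.Properties as Unique
open import Data.List.Membership.Propositional using (_∈_; _∉_)
open import Data.List.Membership.Propositional.Properties using (∈-filter⁺; ∈-filter⁻)
open import Data.List.Membership.DecPropositional using () renaming (_∈?_ to ∈?-with)
open import Function using (_∘_)
open import Function.Bundles using (Equivalence)
open import Relation.Binary.Definitions using (DecidableEquality; Symmetric)
open import Relation.Nullary using (yes; no; ¬?)
open import Relation.Binary.PropositionalEquality using (_≡_; _≢_; refl; sym; trans; cong₂)

-- Two distinct vertices a, b of X have at least three common neighbours (those in X′),
-- whereas two vertices in different rows and columns have only the two "corners"
-- (row a, col b) and (row b, col a); so a and b share a row or a column, a line.
-- Every common neighbour of two distinct points of a line lies on that line, so X′ lies on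
-- the line through a and b, and then, applying the same fact to two points of X′, so does X.

module _ {a} {A : Set a} (_≟_ : DecidableEquality A) where

  longer-Unique⇒∃∉ : {xs : List A} (ys : List A) → Unique xs → length ys < length xs →
                     ∃[ x ] x ∈ xs × x ∉ ys
  longer-Unique⇒∃∉ {x ∷ xs} ys (x∉xs ∷ xs!) ∣ys∣<∣x∷xs∣ with ∈?-with _≟_ x ys
  ... | no x∉ys = x , here refl , x∉ys
  -- By uniqueness x ∉ xs, so removing x from ys loses no obstruction for xs.
  ... | yes x∈ys with longer-Unique⇒∃∉ ys-x xs! ∣ys-x∣<∣xs∣
    where
      ys-x = filter (λ y → ¬? (y ≟ x)) ys
      ∣ys-x∣<∣xs∣ : length ys-x < length xs
      ∣ys-x∣<∣xs∣ = <-≤-trans (filter-notAll _ ys (Any.map (λ y≡x y≢x → y≢x (sym y≡x)) x∈ys))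
                             (s≤s⁻¹ ∣ys∣<∣x∷xs∣)
  ...   | y , y∈xs , y∉ys-x =
          y , there y∈xs , λ y∈ys → y∉ys-x (∈-filter⁺ _ y∈ys (λ y≡x → All.lookup x∉xs y∈xs (sym y≡x)))

module _ {g : ℕ} where

  private
    V = Vertex g

  _≟V_ : DecidableEquality V
  _≟V_ = ≡-dec Fin._≟_ Fin._≟_

  allVertices-Unique : Unique (allVertices g)
  allVertices-Unique = Unique.cartesianProduct⁺ (Unique.allFin⁺ g) (Unique.allFin⁺ g)

  ∃∉-of-card : (X : VSet g) (ys : List V) → length ys < card X → ∃[ v ] v ∈V X × v ∉ ys
  ∃∉-of-card X ys ∣ys∣<∣X∣
    with longer-Unique⇒∃∉ _≟V_ ys (Unique.filter⁺ (T? ∘ X) allVertices-Unique) ∣ys∣<∣X∣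
  ... | v , v∈X , v∉ys =
        v , Equivalence.to T-≡ (proj₂ (∈-filter⁻ (T? ∘ X) {xs = allVertices g} v∈X)) , v∉ys

  ∃-two-distinct : (X : VSet g) → card X ≥ 2 → ∃[ a ] ∃[ b ] a ∈V X × b ∈V X × a ≢ b
  ∃-two-distinct X ∣X∣≥2 with ∃∉-of-card X [] (≤-trans (n≤1+n 1) ∣X∣≥2)
  ... | a , a∈X , _ with ∃∉-of-card X (a ∷ []) ∣X∣≥2
  ...   | b , b∈X , b∉[a] = a , b , a∈X , b∈X , λ a≡b → b∉[a] (here (sym a≡b))

  ∃-avoiding-two : (X : VSet g) → card X ≥ 3 → (c d : V) → ∃[ v ] v ∈V X × v ≢ c × v ≢ d
  ∃-avoiding-two X ∣X∣≥3 c d with ∃∉-of-card X (c ∷ d ∷ []) ∣X∣≥3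
  ... | v , v∈X , v∉[c,d] =
        v , v∈X , (λ v≡c → v∉[c,d] (here v≡c)) , (λ v≡d → v∉[c,d] (there (here v≡d)))

  Edge-sym : Symmetric (Edge {g})
  Edge-sym (inj₁ r≡) = inj₁ (sym r≡)
  Edge-sym (inj₂ c≡) = inj₂ (sym c≡)

  common-neighbour : {p q v : V} → Edge v p → Edge v q →
                     Edge p q ⊎ (v ≡ (row p , col q) ⊎ v ≡ (row q , col p))
  common-neighbour (inj₁ vp) (inj₁ vq) = inj₁ (inj₁ (trans (sym vp) vq))
  common-neighbour (inj₁ vp) (inj₂ vq) = inj₂ (inj₁ (cong₂ _,_ vp vq))
  common-neighbour (inj₂ vp) (inj₁ vq) = inj₂ (inj₂ (cong₂ _,_ vq vp))
  common-neighbour (inj₂ vp) (inj₂ vq) = inj₁ (inj₂ (trans (sym vp) vq))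

  common-neighbour-on-row : {p q v : V} → p ≢ q → row p ≡ row q → Edge v p → Edge v q → row v ≡ row p
  common-neighbour-on-row _   _  (inj₁ vp) _         = vp
  common-neighbour-on-row _   pq (inj₂ _)  (inj₁ vq) = trans vq (sym pq)
  common-neighbour-on-row p≢q pq (inj₂ vp) (inj₂ vq) = ⊥-elim (p≢q (cong₂ _,_ pq (trans (sym vp) vq)))

  common-neighbour-on-col : {p q v : V} → p ≢ q → col p ≡ col q → Edge v p → Edge v q → col v ≡ col p
  common-neighbour-on-col _   _  (inj₂ vp) _         = vp
  common-neighbour-on-col _   pq (inj₁ _)  (inj₂ vq) = trans vq (sym pq)
  common-neighbour-on-col p≢q pq (inj₁ vp) (inj₁ vq) = ⊥-elim (p≢q (cong₂ _,_ (trans (sym vp) vq) pq))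

  AllAdjacent : VSet g → VSet g → Set
  AllAdjacent X Y = ∀ u v → u ∈V X → v ∈V Y → Edge u v

  AllAdjacent-sym : {X Y : VSet g} → AllAdjacent X Y → AllAdjacent Y X
  AllAdjacent-sym X⋈Y u v u∈Y v∈X = Edge-sym (X⋈Y v u v∈X u∈Y)

  adjacent-within : {X Y : VSet g} → AllAdjacent X Y → card Y ≥ 3 →
                    {a b : V} → a ∈V X → b ∈V X → Edge a b
  adjacent-within {Y = Y} X⋈Y ∣Y∣≥3 {a} {b} a∈X b∈X
    with ∃-avoiding-two Y ∣Y∣≥3 (row a , col b) (row b , col a)
  ... | v , v∈Y , v≢ab , v≢ba
    with common-neighbour (Edge-sym (X⋈Y a v a∈X v∈Y)) (Edge-sym (X⋈Y b v b∈X v∈Y))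
  ...   | inj₁ ab        = ab
  ...   | inj₂ (inj₁ v≡) = ⊥-elim (v≢ab v≡)
  ...   | inj₂ (inj₂ v≡) = ⊥-elim (v≢ba v≡)

  module Line (π : V → Fin g)
              (common-neighbour-on-line : {p q v : V} → p ≢ q → π p ≡ π q →
                                          Edge v p → Edge v q → π v ≡ π p) where

    neighbours-on-line : {X Y : VSet g} → AllAdjacent X Y → {a b : V} → a ∈V X → b ∈V X →
                         a ≢ b → π a ≡ π b → ∀ v → v ∈V Y → π v ≡ π a
    neighbours-on-line X⋈Y a∈X b∈X a≢b ab v v∈Y =
      common-neighbour-on-line a≢b ab (Edge-sym (X⋈Y _ v a∈X v∈Y)) (Edge-sym (X⋈Y _ v b∈X v∈Y))

    union-on-line : {X Y : VSet g} → AllAdjacent X Y → card Y ≥ 2 → {a b : V} → a ∈V X → b ∈V X →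
                    a ≢ b → π a ≡ π b → ∀ v → v ∈V X ⊎ v ∈V Y → π v ≡ π a
    union-on-line {X} {Y} X⋈Y ∣Y∣≥2 {a} a∈X b∈X a≢b ab = on-line
      where
        Y-on-line : ∀ v → v ∈V Y → π v ≡ π a
        Y-on-line = neighbours-on-line X⋈Y a∈X b∈X a≢b ab
        on-line : ∀ v → v ∈V X ⊎ v ∈V Y → π v ≡ π a
        on-line v (inj₂ v∈Y) = Y-on-line v v∈Y
        on-line v (inj₁ v∈X) with ∃-two-distinct Y ∣Y∣≥2
        ... | a′ , b′ , a′∈Y , b′∈Y , a′≢b′ =
              trans (neighbours-on-line (AllAdjacent-sym X⋈Y) a′∈Y b′∈Y a′≢b′
                       (trans (Y-on-line a′ a′∈Y) (sym (Y-on-line b′ b′∈Y))) v v∈X)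
                    (Y-on-line a′ a′∈Y)

  open Line row common-neighbour-on-row using () renaming (union-on-line to union-on-row) public
  open Line col common-neighbour-on-col using () renaming (union-on-line to union-on-col) public

lemma8 : (g : ℕ) (X X′ : VSet g) →
         card X ≥ 3 → card X′ ≥ 3 →
         (∀ u v → u ∈V X → v ∈V X′ → Edge u v) →
         (Σ (Fin g) λ r → ∀ v → (v ∈V X ⊎ v ∈V X′) → row v ≡ r)
           ⊎ (Σ (Fin g) λ c → ∀ v → (v ∈V X ⊎ v ∈V X′) → col v ≡ c)
lemma8 g X X′ ∣X∣≥3 ∣X′∣≥3 X⋈X′ with ∃-two-distinct X (≤-trans (n≤1+n 2) ∣X∣≥3)
... | a , b , a∈X , b∈X , a≢b with adjacent-within X⋈X′ ∣X′∣≥3 a∈X b∈X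
...   | inj₁ same-row = inj₁ (row a , union-on-row X⋈X′ (≤-trans (n≤1+n 2) ∣X′∣≥3) a∈X b∈X a≢b same-row)
...   | inj₂ same-col = inj₂ (col a , union-on-col X⋈X′ (≤-trans (n≤1+n 2) ∣X′∣≥3) a∈X b∈X a≢b same-col)
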